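{- Let $q$ be an odd prime power, $d$ a positive integer, and $\varphi_d$ the coloring defined in the context. Let $A, B \subseteq (\mathbb{F}_q^*)^d$ be disjoint sets of vectors and $\alpha \in C_d$ a color such that $\varphi_d(a,b) = \alpha$ for all $a \in A$ and $b \in B$. Then $A$ confines $B$ or $B$ confines $A$ (or both).
   Context: $\mathbb{F}_q^*$ is the set of nonzero elements of $\mathbb{F}_q$, with an arbitrary fixed linear order; $(\mathbb{F}_q^*)^d$ is ordered lexicographically. $C_d = \mathrm{DOT} \sqcup \mathrm{ZERO} \sqcup \mathrm{UP} \sqcup \mathrm{DOWN}$, with $\mathrm{DOT} = \mathbb{F}_q^*$ and ZERO, UP, DOWN disjoint copies of $\{1,\ldots,d\}\times\mathbb{F}_q$. For distinct $x<y$, with $i$ the first coordinate where they differ and $\cdot$ the standard dot product, $\varphi_d(x,y)=\varphi_d(y,x)$ equals $(i,x_i+y_i)_{\mathrm{ZERO}}$ if $x\cdot y=0$; $(i,x_i+y_i)_{\mathrm{UP}}$ if $x\cdot y\neq 0$ and $x\cdot y = x\cdot x$; $(i,x_i+y_i)_{\mathrm{DOWN}}$ if $x\cdot y\notin\{0,x\cdot x\}$ and $x\cdot y = y\cdot y$; and $x\cdot y\in\mathrm{DOT}$ otherwise. For disjoint sets $A,B$, $A$ confines $B$ if for each $a \in A$, $a\cdot x = a \cdot y$ for all $x,y\in B$. -}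

module Defs where

open import Data.Nat using (ℕ; zero; suc)
open import Data.Fin using (Fin; zero; suc)
open import Data.Vec using (Vec; []; _∷_; zipWith; foldr)
open import Data.Vec.Relation.Unary.All using (All)
open import Data.List using (List)
open import Data.List.Membership.Propositional using (_∈_)
open import Data.Maybe using (Maybe; just; nothing)
import Data.Maybe as Maybe
open import Data.Product using (Σ; ∃; _×_; _,_)
open import Data.Empty using (⊥)
open import Data.Sum using (_⊎_)
open import Function.Bundles using (_↔_)
open import Relation.Nullary using (yes; no; ¬_)
open import Relation.Binary.PropositionalEquality using (_≡_; _≢_)
open import Relation.Binary.Definitions using (tri<; tri≈; tri>)
open import Relation.Binary.Structures using (IsStrictTotalOrder)
open import Algebra.Structures using (IsCommutativeRing)

record FiniteField (q : ℕ) : Set₁ where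
  field
    Carrier           : Set
    _+_ _*_           : Carrier → Carrier → Carrier
    -_                : Carrier → Carrier
    0# 1#             : Carrier
    isCommutativeRing : IsCommutativeRing _≡_ _+_ _*_ -_ 0# 1#
    0≢1               : 0# ≢ 1#
    inverse           : ∀ x → x ≢ 0# → ∃ λ y → (x * y) ≡ 1#
    card              : Carrier ↔ Fin q

-- Everything below is relative to a finite field 𝔽 and a fixed (arbitrary)
-- strict linear order _<_ on its elements (only its restriction to the
-- nonzero elements matters).
module Coloring {q : ℕ} (𝔽 : FiniteField q)
                (_<_ : FiniteField.Carrier 𝔽 → FiniteField.Carrier 𝔽 → Set)
                (<-sto : IsStrictTotalOrder _≡_ _<_) where

  open FiniteField 𝔽
  open IsStrictTotalOrder <-sto using (compare; _≟_)

  NonzeroVec : ∀ {d} → Vec Carrier d → Set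
  NonzeroVec = All (λ x → x ≢ 0#)

  _·_ : ∀ {d} → Vec Carrier d → Vec Carrier d → Carrier
  x · y = foldr _ _+_ 0# (zipWith _*_ x y)

  data Color (d : ℕ) : Set where
    dot  : (c : Carrier) → c ≢ 0# → Color d
    zer  : Fin d → Carrier → Color d
    up   : Fin d → Carrier → Color d
    down : Fin d → Carrier → Color d

  firstDiff : ∀ {d} → Vec Carrier d → Vec Carrier d → Maybe (Fin d × Carrier × Carrier)
  firstDiff [] [] = nothing
  firstDiff (x ∷ xs) (y ∷ ys) with compare x y
  ... | tri≈ _ _ _ = Maybe.map (λ { (i , a , b) → (suc i , a , b) }) (firstDiff xs ys)
  ... | tri< _ _ _ = just (zero , x , y)
  ... | tri> _ _ _ = just (zero , x , y)

  -- colour of the pair (u , v) with u < v lexicographically, i first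
  -- differing coordinate, s = u_i + v_i
  colorOrdered : ∀ {d} → Fin d → Carrier → Vec Carrier d → Vec Carrier d → Color d
  colorOrdered i s u v with (u · v) ≟ 0#
  ... | yes _ = zer i s
  ... | no uv≢0 with (u · v) ≟ (u · u)
  ...   | yes _ = up i s
  ...   | no _ with (u · v) ≟ (v · v)
  ...     | yes _ = down i s
  ...     | no _  = dot (u · v) uv≢0

  -- φ_d(x , y); nothing iff x = y (φ_d is only defined on distinct pairs)
  φ : ∀ {d} → Vec Carrier d → Vec Carrier d → Maybe (Color d)
  φ x y with firstDiff x y
  ... | nothing = nothing
  ... | just (i , xi , yi) with compare xi yi
  ...   | tri< _ _ _ = just (colorOrdered i (xi + yi) x y)
  ...   | tri≈ _ _ _ = just (colorOrdered i (xi + yi) x y)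
  ...   | tri> _ _ _ = just (colorOrdered i (xi + yi) y x)

  Disjoint : ∀ {d} → List (Vec Carrier d) → List (Vec Carrier d) → Set
  Disjoint A B = ∀ {x} → x ∈ A → x ∈ B → ⊥

  Confines : ∀ {d} → List (Vec Carrier d) → List (Vec Carrier d) → Set
  Confines A B = ∀ {a x y} → a ∈ A → x ∈ B → y ∈ B → (a · x) ≡ (a · y)

-- A dot or ZERO colour fixes the value a · b itself, so A confines B.
-- An UP or DOWN colour (i , s) fixes the first differing coordinate i and the sum
-- aᵢ + bᵢ = s; by cancellation aᵢ is then the same for every a ∈ A and bᵢ for
-- every b ∈ B, so all pairs are oriented the same way at i. For UP this means
-- u · v = u · u for the lower vector u of every pair, so the lower side confines
-- the other; DOWN is the mirror image.
module Submission where

open import Defs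
open import Data.Nat using (ℕ; _%_; _≥_)
open import Data.Fin using (Fin)
open import Data.Vec using (Vec; []; _∷_; lookup)
open import Data.List using (List; []; _∷_)
open import Data.List.Relation.Unary.All using (All)
open import Data.List.Relation.Unary.Any using (here)
open import Data.List.Membership.Propositional using (_∈_)
open import Data.Maybe using (just; nothing)
open import Data.Product using (∃; _×_; _,_; proj₁; proj₂)
open import Data.Sum using (_⊎_; inj₁; inj₂)
open import Data.Empty using (⊥-elim)
open import Relation.Nullary using (yes; no)
open import Relation.Binary.PropositionalEquality using (_≡_; _≢_; refl; sym; trans; cong₂; subst₂)
open import Relation.Binary.Definitions using (tri<; tri≈; tri>)
open import Relation.Binary.Structures using (IsStrictTotalOrder)
open import Algebra.Bundles using (CommutativeRing)

module ColoringProperties {q : ℕ} (𝔽 : FiniteField q)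
         (_<_ : FiniteField.Carrier 𝔽 → FiniteField.Carrier 𝔽 → Set)
         (<-sto : IsStrictTotalOrder _≡_ _<_) where

  open FiniteField 𝔽
  open Coloring 𝔽 _<_ <-sto
  open IsStrictTotalOrder <-sto using (compare; _≟_; asym)

  ring : CommutativeRing _ _
  ring = record { isCommutativeRing = isCommutativeRing }

  open CommutativeRing ring using (+-group; *-comm)
  open import Algebra.Properties.Group +-group using (∙-cancelˡ; ∙-cancelʳ)

  ·-comm : ∀ {d} (x y : Vec Carrier d) → x · y ≡ y · x
  ·-comm []       []       = refl
  ·-comm (x ∷ xs) (y ∷ ys) = cong₂ _+_ (*-comm x y) (·-comm xs ys)

  firstDiff-sound : ∀ {d} (x y : Vec Carrier d) {i xᵢ yᵢ} → firstDiff x y ≡ just (i , xᵢ , yᵢ)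
                  → lookup x i ≡ xᵢ × lookup y i ≡ yᵢ × xᵢ ≢ yᵢ
  firstDiff-sound (x ∷ xs) (y ∷ ys) eq with compare x y
  firstDiff-sound (x ∷ xs) (y ∷ ys) refl | tri< _ x≢y _ = refl , refl , x≢y
  firstDiff-sound (x ∷ xs) (y ∷ ys) refl | tri> _ x≢y _ = refl , refl , x≢y
  firstDiff-sound (x ∷ xs) (y ∷ ys) eq   | tri≈ _ _ _ with firstDiff xs ys in fd
  firstDiff-sound (x ∷ xs) (y ∷ ys) refl | tri≈ _ _ _ | just _ = firstDiff-sound xs ys fd

  ColorSpec : ∀ {d} → Color d → Fin d → Carrier → Vec Carrier d → Vec Carrier d → Set
  ColorSpec (dot c _)  i s u v = u · v ≡ c
  ColorSpec (zer _ _)  i s u v = u · v ≡ 0#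
  ColorSpec (up j t)   i s u v = i ≡ j × s ≡ t × u · v ≡ u · u
  ColorSpec (down j t) i s u v = i ≡ j × s ≡ t × u · v ≡ v · v

  colorOrdered-spec : ∀ {d} i s (u v : Vec Carrier d) → ColorSpec (colorOrdered i s u v) i s u v
  colorOrdered-spec i s u v with (u · v) ≟ 0#
  ... | yes uv≡0 = uv≡0
  ... | no _ with (u · v) ≟ (u · u)
  ...   | yes uv≡uu = refl , refl , uv≡uu
  ...   | no _ with (u · v) ≟ (v · v)
  ...     | yes uv≡vv = refl , refl , uv≡vv
  ...     | no _ = refl

  data OrientedAt {d} (i : Fin d) (P : Vec Carrier d → Vec Carrier d → Set) (a b : Vec Carrier d) : Set where
    below : lookup a i < lookup b i → P a b → OrientedAt i P a b
    above : lookup b i < lookup a i → P b a → OrientedAt i P a b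

  φ-spec : ∀ {d} (a b : Vec Carrier d) {c} → φ a b ≡ just c
         → ∃ λ i → OrientedAt i (ColorSpec c i (lookup a i + lookup b i)) a b
  φ-spec a b eq with firstDiff a b in fd
  φ-spec a b ()   | nothing
  φ-spec a b eq   | just (i , _ , _) with firstDiff-sound a b fd
  φ-spec a b eq   | just (i , _ , _) | refl , refl , aᵢ≢bᵢ with compare (lookup a i) (lookup b i)
  φ-spec a b refl | just (i , _ , _) | refl , refl , _ | tri< aᵢ<bᵢ _ _ =
    i , below aᵢ<bᵢ (colorOrdered-spec i _ a b)
  φ-spec a b refl | just (i , _ , _) | refl , refl , _ | tri> _ _ bᵢ<aᵢ =
    i , above bᵢ<aᵢ (colorOrdered-spec i _ b a)
  φ-spec a b eq   | just (i , _ , _) | refl , refl , aᵢ≢bᵢ | tri≈ _ aᵢ≡bᵢ _ = ⊥-elim (aᵢ≢bᵢ aᵢ≡bᵢ)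

  φ-dot : ∀ {d} (a b : Vec Carrier d) {c c≢0} → φ a b ≡ just (dot c c≢0) → a · b ≡ c
  φ-dot a b eq with φ-spec a b eq
  ... | _ , below _ ab≡c = ab≡c
  ... | _ , above _ ba≡c = trans (·-comm a b) ba≡c

  φ-zer : ∀ {d} (a b : Vec Carrier d) {i s} → φ a b ≡ just (zer i s) → a · b ≡ 0#
  φ-zer a b eq with φ-spec a b eq
  ... | _ , below _ ab≡0 = ab≡0
  ... | _ , above _ ba≡0 = trans (·-comm a b) ba≡0

  φ-up : ∀ {d} (a b : Vec Carrier d) {i s} → φ a b ≡ just (up i s)
       → lookup a i + lookup b i ≡ s × OrientedAt i (λ u v → u · v ≡ u · u) a b
  φ-up a b eq with φ-spec a b eq
  ... | _ , below aᵢ<bᵢ (refl , refl , ab≡aa) = refl , below aᵢ<bᵢ ab≡aa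
  ... | _ , above bᵢ<aᵢ (refl , refl , ba≡bb) = refl , above bᵢ<aᵢ ba≡bb

  φ-down : ∀ {d} (a b : Vec Carrier d) {i s} → φ a b ≡ just (down i s)
         → lookup a i + lookup b i ≡ s × OrientedAt i (λ u v → u · v ≡ v · v) a b
  φ-down a b eq with φ-spec a b eq
  ... | _ , below aᵢ<bᵢ (refl , refl , ab≡bb) = refl , below aᵢ<bᵢ ab≡bb
  ... | _ , above bᵢ<aᵢ (refl , refl , ba≡aa) = refl , above bᵢ<aᵢ ba≡aa

  Rectangle : ∀ {d} → (Vec Carrier d → Vec Carrier d → Set) → List (Vec Carrier d) → List (Vec Carrier d) → Set
  Rectangle R A B = ∀ {a b} → a ∈ A → b ∈ B → R a b

  module _ {d} (i : Fin d) where

    coordinates-constant : ∀ {s A B a b a₀ b₀} → Rectangle (λ a b → lookup a i + lookup b i ≡ s) A B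
                         → a ∈ A → b ∈ B → a₀ ∈ A → b₀ ∈ B
                         → lookup a i ≡ lookup a₀ i × lookup b i ≡ lookup b₀ i
    coordinates-constant h ma mb ma₀ mb₀ =
      ∙-cancelʳ _ _ _ (trans (h ma mb₀) (sym (h ma₀ mb₀))) ,
      ∙-cancelˡ _ _ _ (trans (h ma₀ mb) (sym (h ma₀ mb₀)))

    oriented-below : ∀ {P a b x y} → x < y → lookup a i ≡ x → lookup b i ≡ y → OrientedAt i P a b → P a b
    oriented-below _     _    _    (below _ Pab) = Pab
    oriented-below x<y aᵢ≡ bᵢ≡ (above bᵢ<aᵢ _) = ⊥-elim (asym x<y (subst₂ _<_ bᵢ≡ aᵢ≡ bᵢ<aᵢ))

    oriented-above : ∀ {P a b x y} → y < x → lookup a i ≡ x → lookup b i ≡ y → OrientedAt i P a b → P b a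
    oriented-above y<x aᵢ≡ bᵢ≡ (below aᵢ<bᵢ _) = ⊥-elim (asym y<x (subst₂ _<_ aᵢ≡ bᵢ≡ aᵢ<bᵢ))
    oriented-above _     _    _    (above _ Pba) = Pba

    oriented-uniformly : ∀ {s P} (A B : List (Vec Carrier d))
      → Rectangle (λ a b → lookup a i + lookup b i ≡ s × OrientedAt i P a b) A B
      → Rectangle P A B ⊎ Rectangle (λ a b → P b a) A B
    oriented-uniformly []       B        _ = inj₁ λ ()
    oriented-uniformly (a₀ ∷ A) []       _ = inj₁ λ _ ()
    oriented-uniformly (a₀ ∷ A) (b₀ ∷ B) h with proj₂ (h (here refl) (here refl))
    ... | below a₀<b₀ _ = inj₁ λ ma mb →
            let aᵢ≡ , bᵢ≡ = coordinates-constant (λ ma mb → proj₁ (h ma mb)) ma mb (here refl) (here refl)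
            in oriented-below a₀<b₀ aᵢ≡ bᵢ≡ (proj₂ (h ma mb))
    ... | above b₀<a₀ _ = inj₂ λ ma mb →
            let aᵢ≡ , bᵢ≡ = coordinates-constant (λ ma mb → proj₁ (h ma mb)) ma mb (here refl) (here refl)
            in oriented-above b₀<a₀ aᵢ≡ bᵢ≡ (proj₂ (h ma mb))

  confines-of-constant : ∀ {d} {A B : List (Vec Carrier d)} (f : Vec Carrier d → Carrier)
                       → Rectangle (λ a b → a · b ≡ f a) A B → Confines A B
  confines-of-constant f h ma mx my = trans (h ma mx) (sym (h ma my))

  monochromatic⇒confines : ∀ {d} (A B : List (Vec Carrier d)) (α : Color d)
                         → Rectangle (λ a b → φ a b ≡ just α) A B → Confines A B ⊎ Confines B A
  monochromatic⇒confines A B (dot c _) mono =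
    inj₁ (confines-of-constant (λ _ → c) λ {a} {b} ma mb → φ-dot a b (mono ma mb))
  monochromatic⇒confines A B (zer _ _) mono =
    inj₁ (confines-of-constant (λ _ → 0#) λ {a} {b} ma mb → φ-zer a b (mono ma mb))
  monochromatic⇒confines A B (up i _) mono with oriented-uniformly i A B (λ {a} {b} ma mb → φ-up a b (mono ma mb))
  ... | inj₁ ab≡aa = inj₁ (confines-of-constant (λ a → a · a) ab≡aa)
  ... | inj₂ ba≡bb = inj₂ (confines-of-constant (λ b → b · b) λ mb ma → ba≡bb ma mb)
  monochromatic⇒confines A B (down i _) mono with oriented-uniformly i A B (λ {a} {b} ma mb → φ-down a b (mono ma mb))
  ... | inj₁ ab≡bb = inj₂ (confines-of-constant (λ b → b · b) λ {b} {a} mb ma → trans (·-comm b a) (ab≡bb ma mb))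
  ... | inj₂ ba≡aa = inj₁ (confines-of-constant (λ a → a · a) λ {a} {b} ma mb → trans (·-comm a b) (ba≡aa ma mb))

-- Oddness of q, d ≥ 1, nonzero entries and disjointness are not needed.
lemma7 : (q : ℕ) → q % 2 ≡ 1 → (𝔽 : FiniteField q)
         → (_<_ : FiniteField.Carrier 𝔽 → FiniteField.Carrier 𝔽 → Set)
         → (<-sto : IsStrictTotalOrder _≡_ _<_)
         → (d : ℕ) → d ≥ 1
         → (A B : List (Vec (FiniteField.Carrier 𝔽) d))
         → All (Coloring.NonzeroVec 𝔽 _<_ <-sto) A
         → All (Coloring.NonzeroVec 𝔽 _<_ <-sto) B
         → Coloring.Disjoint 𝔽 _<_ <-sto A B
         → (α : Coloring.Color 𝔽 _<_ <-sto d)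
         → (∀ {a b} → a ∈ A → b ∈ B → Coloring.φ 𝔽 _<_ <-sto a b ≡ just α)
         → Coloring.Confines 𝔽 _<_ <-sto A B ⊎ Coloring.Confines 𝔽 _<_ <-sto B A
lemma7 q _ 𝔽 _<_ <-sto d _ A B _ _ _ = ColoringProperties.monochromatic⇒confines 𝔽 _<_ <-sto A B
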